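{- Let $L$ be an index set, let $\mathbb{B}\le\mathbb{A}'(\mathcal{T})^L$ be a subalgebra, and let $C\subseteq B$ satisfy: (1) every $c\in C$ is nowhere $0$, i.e. $c(l)\ne 0$ for all $l\in L$; and (2) if $c\in C$ and $a\in B$ are such that $c(l)\in\{a(l),\partial a(l)\}$ for all $l\in L$, then $c=a$. If $f_1(x),f_2(x),f_3(x)$ are unary polynomials of $\mathbb{B}$ such that for each $i$ either $f_i$ is constant or $f_i^{ -1}(C)\subseteq C$, then the polynomial $f(x)=K(f_1(x),f_2(x),f_3(x))$ is either constant or satisfies $f^{ -1}(C)\subseteq C$.
   Context: $\mathcal{T}$ is a Turing machine with states $\mu_0,\dots,\mu_n$ and $\mathbb{A}'(\mathcal{T})$ is the following algebra. Let $U=\{1,2,H\}$, $W=\{C,D,\partial C,\partial D\}$, $A=\{0\}\cup U\cup W$; for $0\le i\le n$ and $r,s\in\{0,1\}$ let $V_{ir}^s=\{C_{ir}^s,D_{ir}^s,M_i^r,\partial C_{ir}^s,\partial D_{ir}^s,\partial M_i^r\}$, $V_{ir}=V_{ir}^0\cup V_{ir}^1$, $V_i=V_{i0}\cup V_{i1}$, $V=\bigcup_i V_i$ (all symbols distinct). The universe is $A\cup V$. $\partial$ denotes the involution of $V\cup W$ exchanging $x$ and $\partial x$; it is not an operation (in condition (2), $c(l)=\partial a(l)$ requires $a(l)\in V\cup W$). Fundamental operations: - constant $0$ and $\wedge$ making a flat meet semilattice with bottom $0$; for $p,q$ each equal to $x$ or $0$, $p\vee q$ is their join. - multiplication: $2\cdot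 D=H\cdot C=D$, $1\cdot C=C$, $2\cdot\partial D=H\cdot\partial C=\partial D$, $1\cdot\partial C=\partial C$, else $0$. - $J(x,y,z)=x$ if $x=y$; $x\wedge z$ if $x=\partial y\in V\cup W$; $0$ otherwise. $J'(x,y,z)=x\wedge z$ if $x=y$; $x$ if $x=\partial y\in V\cup W$; $0$ otherwise. $K(x,y,z)=y$ if $x=\partial y\in V\cup W$; $z$ if $x=y=\partial z\in V\cup W$; $x\wedge y\wedge z$ otherwise. - $S_0(u,x,y,z)=(x\wedge y)\vee(x\wedge z)$ if $u\in V_0$, else $0$; $S_1(u,x,y,z)=(x\wedge y)\vee(x\wedge z)$ if $u\in\{1,2\}$, else $0$; $S_2(u,v,x,y,z)=(x\wedge y)\vee(x\wedge z)$ if $u=\partial v\in V\cup W$, else $0$. - $T(w,x,y,z)=w\cdot x$ if $w\cdot x=y\cdot z$ and $(w,x)=(y,z)$; $\partial(w\cdot x)$ if $w\cdot x=y\cdot z\ne0$ and $(w,x)\ne(y,z)$; $0$ otherwise. - $I(x)=C_{10}^0$ if $x=1$, $M_1^0$ if $x=H$, $D_{10}^0$ if $x=2$, else $0$. - for each instruction $(\mu_i,r,s,\mathrm{L},\mu_j)$ of $\mathcal{T}$ and $t\in\{0,1\}$: $L_{irt}(x,y,u)=C_{jt}^{s'}$ if $x=y=1$, $u=C_{ir}^{s'}$; $M_j^t$ if $x=H,y=1,u=C_{ir}^t$; $D_{jt}^s$ if $x=2,y=H,u=M_i^r$; $D_{jt}^{s'}$ if $x=y=2,u=D_{ir}^{s'}$;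 $\partial v$ if $u\in V$ and $L_{irt}(x,y,\partial u)=v\in V$ by the preceding clauses; $0$ otherwise. - for each instruction $(\mu_i,r,s,\mathrm{R},\mu_j)$ and $t\in\{0,1\}$: $R_{irt}(x,y,u)=C_{jt}^{s'}$ if $x=y=1,u=C_{ir}^{s'}$; $C_{jt}^s$ if $x=H,y=1,u=M_i^r$; $M_j^t$ if $x=2,y=H,u=D_{ir}^t$; $D_{jt}^{s'}$ if $x=y=2,u=D_{ir}^{s'}$; $\partial v$ if $u\in V$ and $R_{irt}(x,y,\partial u)=v\in V$ by the preceding clauses; $0$ otherwise. - with $\mathcal{L},\mathcal{R}$ the sets of these operations and $x\prec y$ iff $(x,y)\in\{(2,2),(2,H),(1,1)\}$, for each $F\in\mathcal{L}\cup\mathcal{R}$: $U_F^1(x,y,z,u)=\partial F(x,y,u)$ if $x\prec z,y\ne z,F(x,y,u)\ne0$; $F(x,y,u)$ if $x\prec z,y=z,F(x,y,u)\ne0$; $0$ otherwise; and $U_F^0(x,y,z,u)=\partial F(y,z,u)$ if $x\prec z,x\ne y,F(y,z,u)\ne0$; $F(y,z,u)$ if $x\prec z,x=y,F(y,z,u)\ne0$; $0$ otherwise. Operations on $\mathbb{A}'(\mathcal{T})^L$ act coordinatewise. -}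

module Defs where

open import Data.Nat using (ℕ; zero; suc)
open import Data.Fin using (Fin; zero; suc)
import Data.Fin as Fin
open import Data.Bool using (Bool; true; false; if_then_else_; _∧_; _∨_; not)
import Data.Bool as Bool
open import Data.Maybe using (Maybe; just; nothing; maybe)
open import Data.Product using (_×_; _,_)
open import Data.Sum using (_⊎_)
open import Relation.Nullary.Decidable using (⌊_⌋)
open import Relation.Binary.PropositionalEquality using (_≡_; _≢_)

-- Turing machines with states μ₀ … μₙ (here n = suc k, so that the
-- state μ₁ used by the operation I exists), tape alphabet {0,1}
-- (false = 0, true = 1).  A machine is a partial transition function:
-- δ i r = just (s , d , j)  means  (μᵢ, r, s, d, μⱼ) is an instruction.

St : ℕ → Set
St k = Fin (suc (suc k))

data Dir : Set where
  left right : Dir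

record TM : Set where
  field
    k : ℕ
    δ : St k → Bool → Maybe (Bool × Dir × St k)

record Instruction (k : ℕ) : Set where
  constructor instr
  field
    i : St k
    r : Bool
    s : Bool
    d : Dir
    j : St k

IsInstr : (T : TM) → Instruction (TM.k T) → Set
IsInstr T (instr i r s d j) = TM.δ T i r ≡ just (s , d , j)

-- "kinds" of elements of V (without the ∂):  C_{ir}^s, D_{ir}^s, M_i^r
data VK (k : ℕ) : Set where
  cK : St k → Bool → Bool → VK k
  dK : St k → Bool → Bool → VK k
  mK : St k → Bool → VK k

data WK : Set where
  Ck Dk : WK

-- The Bool flag in w / v is true for the ∂-version.
data Elt (k : ℕ) : Set where
  𝟎 𝟏 𝟐 𝐇 : Elt k
  w : Bool → WK → Elt k
  v : Bool → VK k → Elt k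

module _ {k : ℕ} where

  _=F_ : St k → St k → Bool
  a =F b = ⌊ a Fin.≟ b ⌋

  _=B_ : Bool → Bool → Bool
  a =B b = ⌊ a Bool.≟ b ⌋

  eqW : WK → WK → Bool
  eqW Ck Ck = true
  eqW Dk Dk = true
  eqW _ _ = false

  eqV : VK k → VK k → Bool
  eqV (cK i r s) (cK i' r' s') = (i =F i') ∧ (r =B r') ∧ (s =B s')
  eqV (dK i r s) (dK i' r' s') = (i =F i') ∧ (r =B r') ∧ (s =B s')
  eqV (mK i r) (mK i' r') = (i =F i') ∧ (r =B r')
  eqV _ _ = false

  _==_ : Elt k → Elt k → Bool
  𝟎 == 𝟎 = true
  𝟏 == 𝟏 = true
  𝟐 == 𝟐 = true
  𝐇 == 𝐇 = true
  w b x == w b' x' = (b =B b') ∧ eqW x x'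
  v b x == v b' x' = (b =B b') ∧ eqV x x'
  _ == _ = false

  dual : Elt k → Elt k → Bool
  dual (w b x) (w b' x') = not (b =B b') ∧ eqW x x'
  dual (v b x) (v b' x') = not (b =B b') ∧ eqV x x'
  dual _ _ = false

  -- the involution ∂ on V ∪ W (extended by the identity on A ∖ W;
  -- it is only ever applied to elements of V ∪ W or to 0 ↦ 0)
  ∂ : Elt k → Elt k
  ∂ (w b x) = w (not b) x
  ∂ (v b x) = v (not b) x
  ∂ x = x

  Dual : Elt k → Elt k → Set
  Dual x y = dual x y ≡ true

  _⊓_ : Elt k → Elt k → Elt k
  x ⊓ y = if x == y then x else 𝟎

  -- join p ∨ q for p, q ∈ {x, 0}
  _⊔_ : Elt k → Elt k → Elt k
  p ⊔ q = if p == 𝟎 then q else p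

  _·_ : Elt k → Elt k → Elt k
  𝟐 · w b Dk = w b Dk
  𝐇 · w b Ck = w b Dk
  𝟏 · w b Ck = w b Ck
  _ · _ = 𝟎

  opJ : Elt k → Elt k → Elt k → Elt k
  opJ x y z = if x == y then x else (if dual x y then x ⊓ z else 𝟎)

  opJ' : Elt k → Elt k → Elt k → Elt k
  opJ' x y z = if x == y then x ⊓ z else (if dual x y then x else 𝟎)

  opK : Elt k → Elt k → Elt k → Elt k
  opK x y z =
    if dual x y then y
    else (if (x == y) ∧ dual y z then z else (x ⊓ y) ⊓ z)

  inV0 : Elt k → Bool
  inV0 (v _ (cK i _ _)) = i =F zero
  inV0 (v _ (dK i _ _)) = i =F zero
  inV0 (v _ (mK i _)) = i =F zero
  inV0 _ = false

  in12 : Elt k → Bool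
  in12 𝟏 = true
  in12 𝟐 = true
  in12 _ = false

  opS0 : Elt k → Elt k → Elt k → Elt k → Elt k
  opS0 u x y z = if inV0 u then (x ⊓ y) ⊔ (x ⊓ z) else 𝟎

  opS1 : Elt k → Elt k → Elt k → Elt k → Elt k
  opS1 u x y z = if in12 u then (x ⊓ y) ⊔ (x ⊓ z) else 𝟎

  opS2 : Elt k → Elt k → Elt k → Elt k → Elt k → Elt k
  opS2 u u' x y z = if dual u u' then (x ⊓ y) ⊔ (x ⊓ z) else 𝟎

  opT : Elt k → Elt k → Elt k → Elt k → Elt k
  opT a x y z =
    if (a · x) == (y · z)
    then (if (a == y) ∧ (x == z) then a · x
          else (if not ((a · x) == 𝟎) then ∂ (a · x) else 𝟎))
    else 𝟎

  opI : Elt k → Elt k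
  opI 𝟏 = v false (cK (suc zero) false false)
  opI 𝐇 = v false (mK (suc zero) false)
  opI 𝟐 = v false (dK (suc zero) false false)
  opI _ = 𝟎

  -- unprimed clauses of L_{irt} for the instruction (μᵢ,r,s,L,μⱼ)
  baseL : (i : St k) (r s : Bool) (j : St k) (t : Bool) →
          Elt k → Elt k → VK k → Maybe (VK k)
  baseL i r s j t 𝟏 𝟏 (cK i' r' s') =
    if (i' =F i) ∧ (r' =B r) then just (cK j t s') else nothing
  baseL i r s j t 𝐇 𝟏 (cK i' r' s') =
    if (i' =F i) ∧ (r' =B r) ∧ (s' =B t) then just (mK j t) else nothing
  baseL i r s j t 𝟐 𝐇 (mK i' r') =
    if (i' =F i) ∧ (r' =B r) then just (dK j t s) else nothing
  baseL i r s j t 𝟐 𝟐 (dK i' r' s') =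
    if (i' =F i) ∧ (r' =B r) then just (dK j t s') else nothing
  baseL i r s j t _ _ _ = nothing

  -- unprimed clauses of R_{irt} for the instruction (μᵢ,r,s,R,μⱼ)
  baseR : (i : St k) (r s : Bool) (j : St k) (t : Bool) →
          Elt k → Elt k → VK k → Maybe (VK k)
  baseR i r s j t 𝟏 𝟏 (cK i' r' s') =
    if (i' =F i) ∧ (r' =B r) then just (cK j t s') else nothing
  baseR i r s j t 𝐇 𝟏 (mK i' r') =
    if (i' =F i) ∧ (r' =B r) then just (cK j t s) else nothing
  baseR i r s j t 𝟐 𝐇 (dK i' r' s') =
    if (i' =F i) ∧ (r' =B r) ∧ (s' =B t) then just (mK j t) else nothing
  baseR i r s j t 𝟐 𝟐 (dK i' r' s') =
    if (i' =F i) ∧ (r' =B r) then just (dK j t s') else nothing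
  baseR i r s j t _ _ _ = nothing

  -- F = L_{irt} or R_{irt} (according to the direction of the
  -- instruction); the ∂-clause is realised by carrying the flag of u.
  opF : Instruction k → Bool → Elt k → Elt k → Elt k → Elt k
  opF (instr i r s left j) t x y (v b κ) =
    maybe (v b) 𝟎 (baseL i r s j t x y κ)
  opF (instr i r s right j) t x y (v b κ) =
    maybe (v b) 𝟎 (baseR i r s j t x y κ)
  opF _ _ _ _ _ = 𝟎

  prec : Elt k → Elt k → Bool
  prec 𝟐 𝟐 = true
  prec 𝟐 𝐇 = true
  prec 𝟏 𝟏 = true
  prec _ _ = false

  opU1 : (Elt k → Elt k → Elt k → Elt k) →
         Elt k → Elt k → Elt k → Elt k → Elt k
  opU1 F x y z u =
    if prec x z ∧ not (F x y u == 𝟎)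
    then (if y == z then F x y u else ∂ (F x y u))
    else 𝟎

  opU0 : (Elt k → Elt k → Elt k → Elt k) →
         Elt k → Elt k → Elt k → Elt k → Elt k
  opU0 F x y z u =
    if prec x z ∧ not (F y z u == 𝟎)
    then (if x == y then F y z u else ∂ (F y z u))
    else 𝟎

data Op (T : TM) : ℕ → Set where
  o0 : Op T 0
  oMeet oMul : Op T 2
  oJ oJ' oK : Op T 3
  oS0 oS1 oT : Op T 4
  oS2 : Op T 5
  oI : Op T 1
  oF : (ins : Instruction (TM.k T)) → IsInstr T ins → Bool → Op T 3
  -- U^e_F for e ∈ {0,1} (true = 1) and each F ∈ ℒ ∪ ℛ
  oU : Bool → (ins : Instruction (TM.k T)) → IsInstr T ins → Bool → Op T 4

private
  a0 : ∀ {A : Set} {n} → (Fin (suc n) → A) → A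
  a0 f = f zero
  a1 : ∀ {A : Set} {n} → (Fin (suc (suc n)) → A) → A
  a1 f = f (suc zero)
  a2 : ∀ {A : Set} {n} → (Fin (suc (suc (suc n))) → A) → A
  a2 f = f (suc (suc zero))
  a3 : ∀ {A : Set} {n} → (Fin (suc (suc (suc (suc n)))) → A) → A
  a3 f = f (suc (suc (suc zero)))
  a4 : ∀ {A : Set} {n} → (Fin (suc (suc (suc (suc (suc n))))) → A) → A
  a4 f = f (suc (suc (suc (suc zero))))

⟦_⟧ : ∀ {T n} → Op T n → (Fin n → Elt (TM.k T)) → Elt (TM.k T)
⟦ o0 ⟧ a = 𝟎
⟦ oMeet ⟧ a = a0 a ⊓ a1 a
⟦ oMul ⟧ a = a0 a · a1 a
⟦ oJ ⟧ a = opJ (a0 a) (a1 a) (a2 a)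
⟦ oJ' ⟧ a = opJ' (a0 a) (a1 a) (a2 a)
⟦ oK ⟧ a = opK (a0 a) (a1 a) (a2 a)
⟦ oS0 ⟧ a = opS0 (a0 a) (a1 a) (a2 a) (a3 a)
⟦ oS1 ⟧ a = opS1 (a0 a) (a1 a) (a2 a) (a3 a)
⟦ oT ⟧ a = opT (a0 a) (a1 a) (a2 a) (a3 a)
⟦ oS2 ⟧ a = opS2 (a0 a) (a1 a) (a2 a) (a3 a) (a4 a)
⟦ oI ⟧ a = opI (a0 a)
⟦ oF ins _ t ⟧ a = opF ins t (a0 a) (a1 a) (a2 a)
⟦ oU true ins _ t ⟧ a = opU1 (opF ins t) (a0 a) (a1 a) (a2 a) (a3 a)
⟦ oU false ins _ t ⟧ a = opU0 (opF ins t) (a0 a) (a1 a) (a2 a) (a3 a)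

module _ (T : TM) (L : Set) where

  Carrier : Set
  Carrier = L → Elt (TM.k T)

  ⟦_⟧ᴸ : ∀ {n} → Op T n → (Fin n → Carrier) → Carrier
  ⟦ o ⟧ᴸ as l = ⟦ o ⟧ (λ m → as m l)

  IsSubalgebra : (Carrier → Set) → Set
  IsSubalgebra B = ∀ {n} (o : Op T n) (as : Fin n → Carrier) →
                   (∀ m → B (as m)) → B (⟦ o ⟧ᴸ as)

  _≈_ : Carrier → Carrier → Set
  a ≈ b = ∀ l → a l ≡ b l

  data Poly (B : Carrier → Set) : Set where
    var : Poly B
    cst : (b : Carrier) → B b → Poly B
    app : ∀ {n} → Op T n → (Fin n → Poly B) → Poly B

  eval : ∀ {B} → Poly B → Carrier → Carrier
  eval var x = x
  eval (cst b _) x = b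
  eval (app o ps) x = ⟦ o ⟧ᴸ (λ m → eval (ps m) x)

  K[_,_,_] : ∀ {B} → Poly B → Poly B → Poly B → Poly B
  K[ p , q , r ] = app oK λ { zero → p ; (suc zero) → q ; (suc (suc zero)) → r }

  IsConstant : (B : Carrier → Set) → Poly B → Set
  IsConstant B p = ∀ a b → B a → B b → eval p a ≈ eval p b

  PreimageIn : (B : Carrier → Set) → (Carrier → Set) → Poly B → Set
  PreimageIn B C p = ∀ b → B b → C (eval p b) → C b

  ConstOrPreimageIn : (B : Carrier → Set) → (Carrier → Set) → Poly B → Set
  ConstOrPreimageIn B C p = IsConstant B p ⊎ PreimageIn B C p

  -- C is a genuine subset of A^L (invariant under pointwise equality)
  RespectsPW : (Carrier → Set) → Set
  RespectsPW C = ∀ a b → a ≈ b → C a → C b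

-- The whole argument is pointwise.  Unfolding the definition of K, a
-- nonzero value c = K(x,y,z) ∈ A ∪ V arises in exactly one of three ways:
-- x = ∂y and c = y;  x = y = ∂z and c = z;  x = y = z and c = x.
-- Reading this off coordinatewise for c = K(a₁,a₂,a₃) ∈ C (nowhere 0) with
-- aᵢ ∈ B, condition (2) can be applied three times in a row:
--   c(l) ∈ {a₂(l), ∂a₂(l)} for all l, hence c = a₂;
--   then c(l) ∈ {a₁(l), ∂a₁(l)} (∂ has no fixed points), hence c = a₁;
--   then c(l) = a₃(l) for all l.
-- So K(a₁,a₂,a₃) ∈ C forces a₁, a₂, a₃ ∈ C.  If some fᵢ reflects C, then
-- so does K(f₁,f₂,f₃); otherwise all fᵢ are constant and so is K(f₁,f₂,f₃).
module Submission where

open import Defs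
open import Data.Product using (_×_; _,_; proj₁; proj₂)
open import Data.Sum using (_⊎_; inj₁; inj₂)
open import Data.Empty using (⊥-elim)
open import Data.Bool using (true; false; _∧_; if_then_else_)
open import Data.Nat using (ℕ)
import Data.Fin as Fin
import Data.Bool as Bool
open import Function using (_∘_)
open import Relation.Nullary using (Dec; yes; no; ¬_)
open import Relation.Nullary.Decidable using (⌊_⌋)
open import Relation.Binary.Definitions using (DecidableEquality)
open import Relation.Binary.PropositionalEquality
  using (_≡_; _≢_; refl; sym; trans; cong; cong₂; subst)

∧-true : ∀ {a b} → a ∧ b ≡ true → a ≡ true × b ≡ true
∧-true {true} {true} refl = refl , refl

⌊⌋-sound : ∀ {P : Set} (d : Dec P) → ⌊ d ⌋ ≡ true → P
⌊⌋-sound (yes p) _ = p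

⌊⌋-sym : ∀ {A : Set} (_≟_ : DecidableEquality A) (a b : A) →
         ⌊ a ≟ b ⌋ ≡ ⌊ b ≟ a ⌋
⌊⌋-sym _≟_ a b with a ≟ b | b ≟ a
... | yes _ | yes _ = refl
... | no _ | no _ = refl
... | yes a≡b | no b≢a = ⊥-elim (b≢a (sym a≡b))
... | no a≢b | yes b≡a = ⊥-elim (a≢b (sym b≡a))

module _ {k : ℕ} where

  eqW-sound : ∀ {a b} → eqW {k} a b ≡ true → a ≡ b
  eqW-sound {Ck} {Ck} _ = refl
  eqW-sound {Dk} {Dk} _ = refl

  eqW-sym : ∀ a b → eqW {k} a b ≡ eqW {k} b a
  eqW-sym Ck Ck = refl
  eqW-sym Ck Dk = refl
  eqW-sym Dk Ck = refl
  eqW-sym Dk Dk = refl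

  eqV-sound : ∀ {a b : VK k} → eqV a b ≡ true → a ≡ b
  eqV-sound {cK i r s} {cK i' r' s'} e
    with i≡ , rs≡ ← ∧-true e
    with refl ← ⌊⌋-sound (i Fin.≟ i') i≡
    with r≡ , s≡ ← ∧-true rs≡
    with refl ← ⌊⌋-sound (r Bool.≟ r') r≡ | refl ← ⌊⌋-sound (s Bool.≟ s') s≡
    = refl
  eqV-sound {dK i r s} {dK i' r' s'} e
    with i≡ , rs≡ ← ∧-true e
    with refl ← ⌊⌋-sound (i Fin.≟ i') i≡
    with r≡ , s≡ ← ∧-true rs≡
    with refl ← ⌊⌋-sound (r Bool.≟ r') r≡ | refl ← ⌊⌋-sound (s Bool.≟ s') s≡
    = refl
  eqV-sound {mK i r} {mK i' r'} e
    with i≡ , r≡ ← ∧-true e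
    with refl ← ⌊⌋-sound (i Fin.≟ i') i≡ | refl ← ⌊⌋-sound (r Bool.≟ r') r≡
    = refl

  eqV-sym : ∀ (a b : VK k) → eqV a b ≡ eqV b a
  eqV-sym (cK i r s) (cK i' r' s')
    rewrite ⌊⌋-sym Fin._≟_ i i' | ⌊⌋-sym Bool._≟_ r r' | ⌊⌋-sym Bool._≟_ s s' = refl
  eqV-sym (dK i r s) (dK i' r' s')
    rewrite ⌊⌋-sym Fin._≟_ i i' | ⌊⌋-sym Bool._≟_ r r' | ⌊⌋-sym Bool._≟_ s s' = refl
  eqV-sym (mK i r) (mK i' r')
    rewrite ⌊⌋-sym Fin._≟_ i i' | ⌊⌋-sym Bool._≟_ r r' = refl
  eqV-sym (cK _ _ _) (dK _ _ _) = refl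
  eqV-sym (cK _ _ _) (mK _ _) = refl
  eqV-sym (dK _ _ _) (cK _ _ _) = refl
  eqV-sym (dK _ _ _) (mK _ _) = refl
  eqV-sym (mK _ _) (cK _ _ _) = refl
  eqV-sym (mK _ _) (dK _ _ _) = refl

  ==-sound : ∀ {x y : Elt k} → (x == y) ≡ true → x ≡ y
  ==-sound {𝟎} {𝟎} _ = refl
  ==-sound {𝟏} {𝟏} _ = refl
  ==-sound {𝟐} {𝟐} _ = refl
  ==-sound {𝐇} {𝐇} _ = refl
  ==-sound {w b κ} {w b' κ'} e with b≡ , κ≡ ← ∧-true e =
    cong₂ w (⌊⌋-sound (b Bool.≟ b') b≡) (eqW-sound κ≡)
  ==-sound {v b κ} {v b' κ'} e with b≡ , κ≡ ← ∧-true e =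
    cong₂ v (⌊⌋-sound (b Bool.≟ b') b≡) (eqV-sound κ≡)

  Dual-sym : ∀ (x y : Elt k) → Dual x y → Dual y x
  Dual-sym (w b κ) (w b' κ') d rewrite ⌊⌋-sym Bool._≟_ b' b | eqW-sym κ' κ = d
  Dual-sym (v b κ) (v b' κ') d rewrite ⌊⌋-sym Bool._≟_ b' b | eqV-sym κ' κ = d

  Dual-irrefl : ∀ (x : Elt k) → ¬ Dual x x
  Dual-irrefl (w true _) ()
  Dual-irrefl (w false _) ()
  Dual-irrefl (v true _) ()
  Dual-irrefl (v false _) ()

  ⊓-nonzero : ∀ (x y : Elt k) → x ⊓ y ≢ 𝟎 → x ≡ y × x ⊓ y ≡ x
  ⊓-nonzero x y x⊓y≢𝟎 with x == y in e
  ... | true = ==-sound e , refl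
  ... | false = ⊥-elim (x⊓y≢𝟎 refl)

  opK-inner : Elt k → Elt k → Elt k → Elt k
  opK-inner x y z = if (x == y) ∧ dual y z then z else (x ⊓ y) ⊓ z

  opK-dual : ∀ x y z → dual x y ≡ true → opK x y z ≡ y
  opK-dual x y z = cong (λ b → if b then y else opK-inner x y z)

  opK-not-dual : ∀ x y z → dual x y ≡ false → opK x y z ≡ opK-inner x y z
  opK-not-dual x y z = cong (λ b → if b then y else opK-inner x y z)

  opK-inner-dual : ∀ x y z → (x == y) ∧ dual y z ≡ true → opK-inner x y z ≡ z
  opK-inner-dual x y z = cong (λ b → if b then z else (x ⊓ y) ⊓ z)

  opK-inner-meet : ∀ x y z → (x == y) ∧ dual y z ≡ false → opK-inner x y z ≡ (x ⊓ y) ⊓ z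
  opK-inner-meet x y z = cong (λ b → if b then z else (x ⊓ y) ⊓ z)

  data KCase (x y z : Elt k) : Set where
    dual-xy   : Dual x y → opK x y z ≡ y → KCase x y z
    dual-yz   : x ≡ y → Dual y z → opK x y z ≡ z → KCase x y z
    all-equal : x ≡ y → y ≡ z → opK x y z ≡ x → KCase x y z

  K-case : ∀ x y z → opK x y z ≢ 𝟎 → KCase x y z
  K-case x y z K≢𝟎 with dual x y in dxy
  ... | true = dual-xy dxy (opK-dual x y z dxy)
  ... | false with (x == y) ∧ dual y z in e
  ...   | true with x≡y , dyz ← ∧-true e =
    dual-yz (==-sound x≡y) dyz (trans (opK-not-dual x y z dxy) (opK-inner-dual x y z e))
  -- In this branch K≢𝟎 has been specialised to (x ⊓ y) ⊓ z ≢ 𝟎.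
  ...   | false
    with xy≡z , K≡x⊓y ← ⊓-nonzero (x ⊓ y) z K≢𝟎
    with x≡y , x⊓y≡x ← ⊓-nonzero x y (K≢𝟎 ∘ trans K≡x⊓y)
    = all-equal x≡y (trans (sym x≡y) (trans (sym x⊓y≡x) xy≡z))
                (trans (opK-not-dual x y z dxy)
                  (trans (opK-inner-meet x y z e) (trans K≡x⊓y x⊓y≡x)))

  Near : Elt k → Elt k → Set
  Near c a = c ≡ a ⊎ Dual c a

  -- The three consequences of the case analysis used, in this order, to
  -- apply condition (2): a nonzero value of K(x,y,z) is near y; if it
  -- equals y it is near x; if it equals y and x it equals z.
  K-near-y : ∀ x y z → opK x y z ≢ 𝟎 → Near (opK x y z) y
  K-near-y x y z K≢𝟎 with K-case x y z K≢𝟎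
  ... | dual-xy _ K≡y = inj₁ K≡y
  ... | dual-yz _ dyz K≡z = inj₂ (subst (λ c → Dual c y) (sym K≡z) (Dual-sym y z dyz))
  ... | all-equal x≡y _ K≡x = inj₁ (trans K≡x x≡y)

  K-near-x : ∀ x y z → opK x y z ≢ 𝟎 → opK x y z ≡ y → Near (opK x y z) x
  K-near-x x y z K≢𝟎 K≡y with K-case x y z K≢𝟎
  ... | dual-xy dxy K≡y′ = inj₂ (subst (λ c → Dual c x) (sym K≡y′) (Dual-sym x y dxy))
  ... | dual-yz _ dyz K≡z = ⊥-elim (Dual-irrefl y (subst (Dual y) (trans (sym K≡z) K≡y) dyz))
  ... | all-equal _ _ K≡x = inj₁ K≡x

  K-eq-z : ∀ x y z → opK x y z ≢ 𝟎 → opK x y z ≡ y → opK x y z ≡ x → opK x y z ≡ z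
  K-eq-z x y z K≢𝟎 K≡y K≡x with K-case x y z K≢𝟎
  ... | dual-xy dxy _ = ⊥-elim (Dual-irrefl x (subst (Dual x) (trans (sym K≡y) K≡x) dxy))
  ... | dual-yz _ _ K≡z = K≡z
  ... | all-equal x≡y y≡z K≡x′ = trans K≡x′ (trans x≡y y≡z)

  opK-cong : ∀ {x x′ y y′ z z′ : Elt k} → x ≡ x′ → y ≡ y′ → z ≡ z′ →
             opK x y z ≡ opK x′ y′ z′
  opK-cong refl refl refl = refl

module _ (T : TM) (L : Set) {B : Carrier T L → Set} where

  eval-closed : IsSubalgebra T L B → (p : Poly T L B) → ∀ b → B b → B (eval T L p b)
  eval-closed closed var b Bb = Bb
  eval-closed closed (cst c Bc) b Bb = Bc
  eval-closed closed (app o ps) b Bb =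
    closed o (λ m → eval T L (ps m) b) (λ m → eval-closed closed (ps m) b Bb)

  K-constant : ∀ f₁ f₂ f₃ → IsConstant T L B f₁ → IsConstant T L B f₂ →
               IsConstant T L B f₃ → IsConstant T L B (K[_,_,_] T L f₁ f₂ f₃)
  K-constant f₁ f₂ f₃ const₁ const₂ const₃ a b Ba Bb l =
    opK-cong (const₁ a b Ba Bb l) (const₂ a b Ba Bb l) (const₃ a b Ba Bb l)

  module Rigid (C : Carrier T L → Set) (C-resp : RespectsPW T L C)
               (nowhere-𝟎 : ∀ c → C c → ∀ l → c l ≢ 𝟎)
               (rigid : ∀ c a → C c → B a → (∀ l → Near (c l) (a l)) → _≈_ T L c a)
               where

    -- If K(x,y,z) ∈ C for x, y, z ∈ B, then x, y, z ∈ C: condition (2)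
    -- identifies K(x,y,z) successively with y, with x and with z.
    K-reflects : ∀ x y z → B x → B y → B z → C (λ l → opK (x l) (y l) (z l)) →
                 C x × C y × C z
    K-reflects x y z Bx By Bz Cc =
      C-resp c x c≈x Cc , C-resp c y c≈y Cc , C-resp c z c≈z Cc
      where
      c : Carrier T L
      c l = opK (x l) (y l) (z l)

      c≈y : _≈_ T L c y
      c≈y = rigid c y Cc By (λ l → K-near-y (x l) (y l) (z l) (nowhere-𝟎 c Cc l))

      c≈x : _≈_ T L c x
      c≈x = rigid c x Cc Bx (λ l → K-near-x (x l) (y l) (z l) (nowhere-𝟎 c Cc l) (c≈y l))

      c≈z : _≈_ T L c z
      c≈z l = K-eq-z (x l) (y l) (z l) (nowhere-𝟎 c Cc l) (c≈y l) (c≈x l)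

    K-poly-reflects : IsSubalgebra T L B → ∀ f₁ f₂ f₃ b → B b →
                      C (eval T L (K[_,_,_] T L f₁ f₂ f₃) b) →
                      C (eval T L f₁ b) × C (eval T L f₂ b) × C (eval T L f₃ b)
    K-poly-reflects closed f₁ f₂ f₃ b Bb =
      K-reflects (eval T L f₁ b) (eval T L f₂ b) (eval T L f₃ b)
        (eval-closed closed f₁ b Bb) (eval-closed closed f₂ b Bb) (eval-closed closed f₃ b Bb)

lemma3p2 : (T : TM) (L : Set) (B : Carrier T L → Set) →
    IsSubalgebra T L B →
    (C : Carrier T L → Set) →
    RespectsPW T L C →
    (∀ c → C c → B c) →
    (∀ c → C c → ∀ l → c l ≢ 𝟎) →
    (∀ c a → C c → B a → (∀ l → c l ≡ a l ⊎ Dual (c l) (a l)) → _≈_ T L c a) →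
    (f₁ f₂ f₃ : Poly T L B) →
    ConstOrPreimageIn T L B C f₁ →
    ConstOrPreimageIn T L B C f₂ →
    ConstOrPreimageIn T L B C f₃ →
    ConstOrPreimageIn T L B C (K[_,_,_] T L f₁ f₂ f₃)
lemma3p2 T L B closed C C-resp _ nowhere-𝟎 rigid f₁ f₂ f₃ = combine
  where
  open Rigid T L C C-resp nowhere-𝟎 rigid

  reflects : ∀ b → B b → C (eval T L (K[_,_,_] T L f₁ f₂ f₃) b) →
             C (eval T L f₁ b) × C (eval T L f₂ b) × C (eval T L f₃ b)
  reflects = K-poly-reflects closed f₁ f₂ f₃

  combine : ConstOrPreimageIn T L B C f₁ → ConstOrPreimageIn T L B C f₂ →
            ConstOrPreimageIn T L B C f₃ →
            ConstOrPreimageIn T L B C (K[_,_,_] T L f₁ f₂ f₃)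
  combine (inj₂ pre₁) _ _ = inj₂ (λ b Bb → pre₁ b Bb ∘ proj₁ ∘ reflects b Bb)
  combine _ (inj₂ pre₂) _ = inj₂ (λ b Bb → pre₂ b Bb ∘ proj₁ ∘ proj₂ ∘ reflects b Bb)
  combine _ _ (inj₂ pre₃) = inj₂ (λ b Bb → pre₃ b Bb ∘ proj₂ ∘ proj₂ ∘ reflects b Bb)
  combine (inj₁ const₁) (inj₁ const₂) (inj₁ const₃) =
    inj₁ (K-constant T L f₁ f₂ f₃ const₁ const₂ const₃)
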